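{- Let $G$ be a finite connected bipartite graph with vertex set $V(G)=A\cup B$ (disjoint), such that every edge joins a vertex of $A$ to a vertex of $B$, and such that no vertex has valency larger than $3$. Let $n=|B|$ and let $r$ be the number of vertices of $B$ of valency $1$. Then $r\le \frac{3(n+1)}4$. Equality holds if and only if: (1) $G$ is a tree; (2) every vertex in $A$ has valency $3$; (3) every vertex in $B$ has valency $3$ or $1$. -}

module Defs where

open import Data.Nat using (ℕ; zero; suc; _+_; _≤_; _≟_)
open import Data.Bool using (Bool; true; false; if_then_else_)
open import Data.Fin using (Fin; zero; suc; inject₁; fromℕ)
open import Data.List using (List; map; length; filter; allFin)
open import Data.Nat.ListAction using (sum)
open import Data.Sum using (_⊎_; inj₁; inj₂)
open import Data.Product using (_×_)
open import Data.Empty using (⊥)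
open import Relation.Nullary using (¬_)
open import Relation.Binary.PropositionalEquality using (_≡_)
open import Relation.Binary.Construct.Closure.ReflexiveTransitive using (Star)
open import Function.Definitions using (Injective)

-- A finite bipartite graph with parts A = Fin a and B = Fin b:
-- E i j ≡ true iff vertex i ∈ A is adjacent to vertex j ∈ B.
-- (Simple graph: at most one edge between two vertices; all edges go A–B.)
BipGraph : ℕ → ℕ → Set
BipGraph a b = Fin a → Fin b → Bool

module _ {a b : ℕ} (E : BipGraph a b) where

  Vertex : Set
  Vertex = Fin a ⊎ Fin b

  data Adj : Vertex → Vertex → Set where
    ab : ∀ {i j} → E i j ≡ true → Adj (inj₁ i) (inj₂ j)
    ba : ∀ {i j} → E i j ≡ true → Adj (inj₂ j) (inj₁ i)

  Connected : Set
  Connected = ∀ (u v : Vertex) → Star Adj u v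

  degA : Fin a → ℕ
  degA i = sum (map (λ j → if E i j then 1 else 0) (allFin b))

  degB : Fin b → ℕ
  degB j = sum (map (λ i → if E i j then 1 else 0) (allFin a))

  numLeavesB : ℕ
  numLeavesB = length (filter (λ j → degB j ≟ 1) (allFin b))

  MaxValency≤3 : Set
  MaxValency≤3 = (∀ i → degA i ≤ 3) × (∀ j → degB j ≤ 3)

  -- A cycle a₀ b₀ a₁ b₁ … a_m b_m a₀ (m ≥ 1, i.e. length 2(m+1) ≥ 4) with
  -- pairwise distinct vertices. In a bipartite graph every cycle has this form.
  record Cycle : Set where
    field
      m      : ℕ
      m≥1    : 1 ≤ m
      α      : Fin (suc m) → Fin a
      β      : Fin (suc m) → Fin b
      α-inj  : Injective _≡_ _≡_ α
      β-inj  : Injective _≡_ _≡_ β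
      edge₁  : ∀ k → E (α k) (β k) ≡ true
      edge₂  : ∀ (k : Fin m) → E (α (suc k)) (β (inject₁ k)) ≡ true
      close  : E (α zero) (β (fromℕ m)) ≡ true

  Acyclic : Set
  Acyclic = ¬ Cycle

  IsTree : Set
  IsTree = Connected × Acyclic

-- Let e be the number of edges and r the number of leaves in B. Counting edges at A gives
-- e ≤ 3|A|; counting them at B, with every leaf weighted 1 + 2, gives e + 2r ≤ 3|B|; and a
-- connected graph has |A| + |B| ≤ e + 1. With x, y, z the slacks of these three inequalities,
-- 4r + (2x + y + 3z) = 3(|B| + 1), which is the bound; equality forces x = y = z = 0, i.e.
-- valencies 3 on A, valencies 1 and 3 on B, and |A| + |B| = e + 1.
--
-- For the third inequality and its equality case, layer the vertices by their distance from
-- a fixed vertex s. Adjacent vertices lie in layers of different parity, so every edge has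
-- exactly one lower endpoint, while every vertex other than s has a lower neighbour: hence
-- |A| + |B| ≤ e + 1. If a vertex had two lower neighbours, the edge to one of them could be
-- bypassed through s, and a shortest bypass closes up to a cycle; so acyclic graphs attain
-- equality. Conversely, the closing edge of a cycle can be removed without disconnecting the
-- graph, and the count for the smaller graph contradicts |A| + |B| = e + 1.

module Submission where

open import Defs
open import Data.Bool using (Bool; true; false; if_then_else_; _∧_; not; T)
import Data.Bool.Properties as Bool
open import Data.Fin using (Fin; zero; suc; inject₁; fromℕ)
import Data.Fin.Properties as Fin
open import Data.List using (map; length; filter; tabulate)
open import Data.Nat using (ℕ; zero; suc; _+_; _*_; _≤_; _<_; z≤n; s≤s; _≟_; parity; ⌊_/2⌋)
open import Data.Nat.ListAction using () renaming (sum to listSum)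
open import Data.Nat.Properties hiding (_≟_)
open import Data.Nat.Tactic.RingSolver using (solve-∀)
open import Algebra.Properties.CommutativeSemigroup +-commutativeSemigroup using (interchange)
open import Algebra.Properties.Semiring.Sum +-*-semiring
  using (sum-syntax; sum-cong-≗; ∑-comm; ∑-distrib-+; *-distribˡ-sum)
open import Data.Parity using (Parity; 0ℙ; 1ℙ; _⁻¹) renaming (_+_ to _⊕_)
open import Data.Parity.Properties using (⁻¹-involutive; p≢p⁻¹)
open import Data.Product using (_×_; _,_; proj₁; proj₂; ∃-syntax)
open import Data.Product.Function.NonDependent.Propositional using (_×-⇔_)
open import Data.Sum using (_⊎_; inj₁; inj₂)
import Data.Sum as Sum
open import Data.Sum.Properties using (≡-dec; inj₁-injective; inj₂-injective)
open import Data.Vec.Functional using (_∷_)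
open import Function using (_∘_; id; _⇔_; mk⇔; Equivalence)
open import Function.Definitions using (Injective)
import Function.Properties.Equivalence as ⇔
open import Level using (Level; 0ℓ)
open import Relation.Binary using (DecidableEquality)
open import Relation.Binary.Construct.Closure.ReflexiveTransitive using (Star; ε; _◅_; _◅◅_; _⋆; return; reverse)
open import Relation.Binary.Definitions using (tri<; tri≈; tri>)
open import Relation.Binary.PropositionalEquality
open import Relation.Nullary using (¬_; Dec; yes; no; does)
open import Relation.Nullary.Decidable using (_×-dec_; _⊎-dec_; map′; dec-true; dec-false; T?)
open import Relation.Nullary.Negation using (contradiction)
open import Relation.Unary using (Pred; Decidable)

private variable
  a b n : ℕ
  p : Level

-- Finite sums

indicator : Bool → ℕ
indicator b = if b then 1 else 0

count : {P : Pred (Fin n) p} → Decidable P → ℕ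
count {n} P? = ∑[ i < n ] indicator (does (P? i))

∑-const : ∀ n c → ∑[ i < n ] c ≡ n * c
∑-const zero    c = refl
∑-const (suc n) c = cong (c +_) (∑-const n c)

∑-mono-≤ : {f g : Fin n → ℕ} → (∀ i → f i ≤ g i) → ∑[ i < n ] f i ≤ ∑[ i < n ] g i
∑-mono-≤ {zero}  f≤g = z≤n
∑-mono-≤ {suc n} f≤g = +-mono-≤ (f≤g zero) (∑-mono-≤ (f≤g ∘ suc))

∑-mono-< : {f g : Fin n → ℕ} → (∀ i → f i ≤ g i) → ∀ {k} → f k < g k →
           ∑[ i < n ] f i < ∑[ i < n ] g i
∑-mono-< {suc n} f≤g {zero}  fk<gk = +-mono-<-≤ fk<gk (∑-mono-≤ (f≤g ∘ suc))
∑-mono-< {suc n} f≤g {suc k} fk<gk = +-mono-≤-< (f≤g zero) (∑-mono-< (f≤g ∘ suc) fk<gk)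

∑-mono-≡⇒≗ : {f g : Fin n → ℕ} → (∀ i → f i ≤ g i) →
             ∑[ i < n ] f i ≡ ∑[ i < n ] g i → ∀ i → f i ≡ g i
∑-mono-≡⇒≗ f≤g ∑f≡∑g i with m≤n⇒m<n∨m≡n (f≤g i)
... | inj₁ fi<gi = contradiction ∑f≡∑g (<⇒≢ (∑-mono-< f≤g fi<gi))
... | inj₂ fi≡gi = fi≡gi

∑≤n*c : {f : Fin n → ℕ} {c : ℕ} → (∀ i → f i ≤ c) →
            ∑[ i < n ] f i ≤ n * c × (∑[ i < n ] f i ≡ n * c ⇔ (∀ i → f i ≡ c))
∑≤n*c {n} {f} {c} f≤c rewrite sym (∑-const n c) =
  ∑-mono-≤ f≤c , mk⇔ (∑-mono-≡⇒≗ f≤c) sum-cong-≗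

≤-∑ : (f : Fin n → ℕ) (k : Fin n) → f k ≤ ∑[ i < n ] f i
≤-∑ f zero    = m≤m+n _ _
≤-∑ f (suc k) = ≤-trans (≤-∑ (f ∘ suc) k) (m≤n+m _ _)

count-pos : {P : Pred (Fin n) p} (P? : Decidable P) → ∀ {k} → P k → 1 ≤ count P?
count-pos P? {k} pk = subst (_≤ count P?) (cong indicator (dec-true (P? k) pk))
                            (≤-∑ (indicator ∘ does ∘ P?) k)

count-zero : {P : Pred (Fin n) p} (P? : Decidable P) → (∀ i → ¬ P i) → count P? ≡ 0
count-zero {n = zero}  P? ¬P = refl
count-zero {n = suc n} P? ¬P rewrite dec-false (P? zero) (¬P zero) = count-zero (P? ∘ suc) (¬P ∘ suc)

count-≤1 : {P : Pred (Fin n) p} (P? : Decidable P) → (∀ {i j} → P i → P j → i ≡ j) → count P? ≤ 1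
count-≤1 {n = zero}  P? unique = z≤n
count-≤1 {n = suc n} P? unique with P? zero
... | yes p0 = ≤-reflexive (cong suc (count-zero (P? ∘ suc) (λ i pi → contradiction (unique p0 pi) λ ())))
... | no _   = count-≤1 (P? ∘ suc) (λ pi pj → Fin.suc-injective (unique pi pj))

listSum-map-tabulate : ∀ {A : Set} (f : A → ℕ) (g : Fin n → A) →
                       listSum (map f (tabulate g)) ≡ ∑[ i < n ] f (g i)
listSum-map-tabulate {zero}  f g = refl
listSum-map-tabulate {suc n} f g = cong (f (g zero) +_) (listSum-map-tabulate f (g ∘ suc))

length-filter-tabulate : ∀ {A : Set} {P : Pred A p} (P? : Decidable P) (g : Fin n → A) →
                         length (filter P? (tabulate g)) ≡ ∑[ i < n ] indicator (does (P? (g i)))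
length-filter-tabulate {n = zero}  P? g = refl
length-filter-tabulate {n = suc n} P? g with does (P? (g zero))
... | true  = cong suc (length-filter-tabulate P? (g ∘ suc))
... | false = length-filter-tabulate P? (g ∘ suc)

count-unique : {P : Pred (Fin n) p} (P? : Decidable P) → (∀ {i j} → P i → P j → i ≡ j) →
               ∀ {k} → P k → count P? ≡ 1
count-unique P? unique pk = ≤-antisym (count-≤1 P? unique) (count-pos P? pk)

indicator-<?-flip : ∀ {m n} → m ≢ n → indicator (does (m <? n)) + indicator (does (n <? m)) ≡ 1
indicator-<?-flip {m} {n} m≢n with <-cmp m n
... | tri< m<n _ _ rewrite dec-true (m <? n) m<n | dec-false (n <? m) (<⇒≯ m<n) = refl
... | tri≈ _ m≡n _ = contradiction m≡n m≢n
... | tri> _ _ n<m rewrite dec-false (m <? n) (<⇒≯ n<m) | dec-true (n <? m) n<m = refl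

-- The arithmetic of the three counting inequalities

slack≡0⇔ : ∀ {m o n} → m + o ≡ n → (o ≡ 0 ⇔ m ≡ n)
slack≡0⇔ {m} {o} {n} m+o≡n = mk⇔ (λ { refl → trans (sym (+-identityʳ m)) m+o≡n })
  λ { refl → +-cancelˡ-≡ m o 0 (trans m+o≡n (sym (+-identityʳ m))) }

leafIdentity : ∀ {a b e r x y z} → a + b + z ≡ suc e → e + y ≡ a * 3 → e + 2 * r + x ≡ b * 3 →
               4 * r + (2 * x + y + 3 * z) ≡ 3 * (b + 1)
leafIdentity {a} {b} {e} {r} {x} {y} {z} hz hy hx = +-cancelʳ-≡ (3 * e + 3 * a + 3 * b) _ _ (begin
  4 * r + (2 * x + y + 3 * z) + (3 * e + 3 * a + 3 * b) ≡⟨ regroup r x y z e a b ⟩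
  2 * (e + 2 * r + x) + (e + y) + 3 * (a + b + z)     ≡⟨ cong₂ _+_ (cong₂ _+_ (cong (2 *_) hx) hy) (cong (3 *_) hz) ⟩
  2 * (b * 3) + a * 3 + 3 * suc e                     ≡⟨ collect e a b ⟩
  3 * (b + 1) + (3 * e + 3 * a + 3 * b)               ∎)
  where
  open ≡-Reasoning
  regroup : ∀ r x y z e a b → 4 * r + (2 * x + y + 3 * z) + (3 * e + 3 * a + 3 * b)
                            ≡ 2 * (e + 2 * r + x) + (e + y) + 3 * (a + b + z)
  regroup = solve-∀
  collect : ∀ e a b → 2 * (b * 3) + a * 3 + 3 * suc e ≡ 3 * (b + 1) + (3 * e + 3 * a + 3 * b)
  collect = solve-∀

weightedSum≡0⇔ : ∀ x y z → 2 * x + y + 3 * z ≡ 0 ⇔ (z ≡ 0 × y ≡ 0 × x ≡ 0)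
weightedSum≡0⇔ x y z = mk⇔
  (λ s≡0 → let 2x+y≡0 = m+n≡0⇒m≡0 (2 * x + y) s≡0 in
    m+n≡0⇒m≡0 z (m+n≡0⇒n≡0 (2 * x + y) s≡0) ,
    m+n≡0⇒n≡0 (2 * x) 2x+y≡0 ,
    m+n≡0⇒m≡0 x (m+n≡0⇒m≡0 (2 * x) 2x+y≡0))
  (λ { (refl , refl , refl) → refl })

leafBound : ∀ {a b e r} → a + b ≤ suc e → e ≤ a * 3 → e + 2 * r ≤ b * 3 →
            4 * r ≤ 3 * (b + 1)
            × (4 * r ≡ 3 * (b + 1) ⇔ (a + b ≡ suc e × e ≡ a * 3 × e + 2 * r ≡ b * 3))
leafBound {a} {b} {e} {r} vertices≤ edges≤ leaves≤
  with m≤n⇒∃[o]m+o≡n vertices≤ | m≤n⇒∃[o]m+o≡n edges≤ | m≤n⇒∃[o]m+o≡n leaves≤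
... | z , hz | y , hy | x , hx =
  subst (4 * r ≤_) key (m≤m+n _ _) ,
  ⇔.trans (⇔.sym (slack≡0⇔ key))
          (⇔.trans (weightedSum≡0⇔ x y z) (slack≡0⇔ hz ×-⇔ slack≡0⇔ hy ×-⇔ slack≡0⇔ hx))
  where
  key : 4 * r + (2 * x + y + 3 * z) ≡ 3 * (b + 1)
  key = leafIdentity {a} {b} {e} {r} hz hy hx

-- Edges, walks and edge removal

module _ {E : BipGraph a b} where

  Adj-sym : ∀ {u w} → Adj E u w → Adj E w u
  Adj-sym (ab e) = ba e
  Adj-sym (ba e) = ab e

  adj? : ∀ u w → Dec (Adj E u w)
  adj? (inj₁ i) (inj₂ j) = map′ ab (λ { (ab e) → e }) (E i j Bool.≟ true)
  adj? (inj₂ j) (inj₁ i) = map′ ba (λ { (ba e) → e }) (E i j Bool.≟ true)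
  adj? (inj₁ _) (inj₁ _) = no λ ()
  adj? (inj₂ _) (inj₂ _) = no λ ()


_≟ᵥ_ : DecidableEquality (Fin a ⊎ Fin b)
_≟ᵥ_ = ≡-dec Fin._≟_ Fin._≟_

anyVertex? : {P : Pred (Fin a ⊎ Fin b) 0ℓ} → Decidable P → Dec (∃[ u ] P u)
anyVertex? P? = map′ (λ { (inj₁ (i , p)) → inj₁ i , p ; (inj₂ (j , p)) → inj₂ j , p })
                     (λ { (inj₁ i , p) → inj₁ (i , p) ; (inj₂ j , p) → inj₂ (j , p) })
                     (Fin.any? (P? ∘ inj₁) ⊎-dec Fin.any? (P? ∘ inj₂))

edgeCount : BipGraph a b → ℕ
edgeCount {a} {b} E = ∑[ i < a ] ∑[ j < b ] indicator (E i j)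

removeEdge : Fin a → Fin b → BipGraph a b → BipGraph a b
removeEdge x y E i j = E i j ∧ not (does (i Fin.≟ x) ∧ does (j Fin.≟ y))

module RemoveEdge (E : BipGraph a b) (x : Fin a) (y : Fin b) where

  E′ : BipGraph a b
  E′ = removeEdge x y E

  removeEdge-⊆ : ∀ {i j} → E′ i j ≡ true → E i j ≡ true
  removeEdge-⊆ {i} {j} e′ with E i j
  ... | true = refl

  removeEdge-keeps : ∀ {i j} → E i j ≡ true → i ≢ x ⊎ j ≢ y → E′ i j ≡ true
  removeEdge-keeps {i} {j} e (inj₁ i≢x) rewrite e | dec-false (i Fin.≟ x) i≢x = refl
  removeEdge-keeps {i} {j} e (inj₂ j≢y) rewrite e | dec-false (j Fin.≟ y) j≢y =
    cong not (Bool.∧-zeroʳ _)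

  removeEdge-removes : E′ x y ≡ false
  removeEdge-removes rewrite dec-true (x Fin.≟ x) refl | dec-true (y Fin.≟ y) refl = Bool.∧-zeroʳ _

  Adj-removeEdge : ∀ {u w} → Adj E u w →
                   (u ≢ inj₁ x × w ≢ inj₁ x) ⊎ (u ≢ inj₂ y × w ≢ inj₂ y) → Adj E′ u w
  Adj-removeEdge (ab e) (inj₁ (u≢x , _)) = ab (removeEdge-keeps e (inj₁ (u≢x ∘ cong inj₁)))
  Adj-removeEdge (ab e) (inj₂ (_ , w≢y)) = ab (removeEdge-keeps e (inj₂ (w≢y ∘ cong inj₂)))
  Adj-removeEdge (ba e) (inj₁ (_ , w≢x)) = ba (removeEdge-keeps e (inj₁ (w≢x ∘ cong inj₁)))
  Adj-removeEdge (ba e) (inj₂ (u≢y , _)) = ba (removeEdge-keeps e (inj₂ (u≢y ∘ cong inj₂)))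

  removeEdge-< : E x y ≡ true → edgeCount E′ < edgeCount E
  removeEdge-< exy = ∑-mono-< (λ i → ∑-mono-≤ (⊆-indicator i)) (∑-mono-< (⊆-indicator x) removed)
    where
    ⊆-indicator : ∀ i j → indicator (E′ i j) ≤ indicator (E i j)
    ⊆-indicator i j with E′ i j in e′
    ... | true  rewrite removeEdge-⊆ e′ = ≤-refl
    ... | false = z≤n

    removed : indicator (E′ x y) < indicator (E x y)
    removed rewrite removeEdge-removes | exy = s≤s z≤n

  removeEdge-connected : Star (Adj E′) (inj₂ y) (inj₁ x) → Connected E → Connected E′
  removeEdge-connected y⇝x conn u w = (bypass ⋆) (conn u w)
    where
    bypass : ∀ {u w} → Adj E u w → Star (Adj E′) u w
    bypass (ab {i} {j} e) with i Fin.≟ x | j Fin.≟ y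
    ... | yes refl | yes refl = reverse Adj-sym y⇝x
    ... | no i≢x   | _        = return (ab (removeEdge-keeps e (inj₁ i≢x)))
    ... | yes _    | no j≢y   = return (ab (removeEdge-keeps e (inj₂ j≢y)))
    bypass (ba {i} {j} e) with i Fin.≟ x | j Fin.≟ y
    ... | yes refl | yes refl = y⇝x
    ... | no i≢x   | _        = return (ba (removeEdge-keeps e (inj₁ i≢x)))
    ... | yes _    | no j≢y   = return (ba (removeEdge-keeps e (inj₂ j≢y)))

-- Breadth-first layers

parity-suc-⊕ : ∀ k q → (parity k ⊕ q) ⁻¹ ≡ parity (suc k) ⊕ q
parity-suc-⊕ zero          q = refl
parity-suc-⊕ (suc zero)    q = ⁻¹-involutive q
parity-suc-⊕ (suc (suc k)) q = parity-suc-⊕ k q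

module Layers (F : BipGraph a b) (s : Vertex F) where

  Within : ℕ → Pred (Vertex F) 0ℓ
  Within zero    u = u ≡ s
  Within (suc k) u = Within k u ⊎ ∃[ w ] (Adj F w u × Within k w)

  within? : ∀ k → Decidable (Within k)
  within? zero    u = u ≟ᵥ s
  within? (suc k) u = within? k u ⊎-dec anyVertex? (λ w → adj? w u ×-dec within? k w)

  Within-mono : ∀ {l k u} → l ≤ k → Within l u → Within k u
  Within-mono {k = zero}  z≤n   r = r
  Within-mono {k = suc k} l≤1+k r with m≤n⇒m<n∨m≡n l≤1+k
  ... | inj₁ (s≤s l≤k) = inj₁ (Within-mono l≤k r)
  ... | inj₂ refl      = r

  reachable⇒Within : ∀ {u} → Star (Adj F) s u → ∃[ k ] Within k u
  reachable⇒Within = extend {0} refl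
    where
    extend : ∀ {k v u} → Within k v → Star (Adj F) v u → ∃[ l ] Within l u
    extend {k} r ε         = k , r
    extend     r (v~w ◅ p) = extend (inj₂ (_ , v~w , r)) p

  Dist : ℕ → Pred (Vertex F) 0ℓ
  Dist zero    u = u ≡ s
  Dist (suc k) u = Within (suc k) u × ¬ Within k u

  Dist⇒Within : ∀ {k u} → Dist k u → Within k u
  Dist⇒Within {zero}  du = du
  Dist⇒Within {suc k} du = proj₁ du

  Dist⇒¬Within : ∀ {k l u} → Dist k u → l < k → ¬ Within l u
  Dist⇒¬Within {suc k} (_ , ¬r) (s≤s l≤k) = ¬r ∘ Within-mono l≤k

  Dist-unique : ∀ {k l u} → Dist k u → Dist l u → k ≡ l
  Dist-unique {k} {l} dk dl with <-cmp k l
  ... | tri< k<l _ _ = contradiction (Dist⇒Within dk) (Dist⇒¬Within dl k<l)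
  ... | tri≈ _ k≡l _ = k≡l
  ... | tri> _ _ l<k = contradiction (Dist⇒Within dl) (Dist⇒¬Within dk l<k)

  Within⇒Dist : ∀ {k u} → Within k u → ∃[ l ] Dist l u
  Within⇒Dist {zero}      r = 0 , r
  Within⇒Dist {suc k} {u} r with within? k u
  ... | yes r′ = Within⇒Dist r′
  ... | no ¬r′ = suc k , r , ¬r′

  Dist-parent : ∀ {k u} → Dist (suc k) u → ∃[ w ] (Adj F w u × Dist k w)
  Dist-parent         (inj₁ r , ¬r)              = contradiction r ¬r
  Dist-parent {zero}  (inj₂ (w , w~u , rw) , ¬r) = w , w~u , rw
  Dist-parent {suc k} (inj₂ (w , w~u , rw) , ¬r) = w , w~u , rw , ¬r ∘ λ r → inj₂ (w , w~u , r)

  side : Vertex F → Parity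
  side (inj₁ _) = 0ℙ
  side (inj₂ _) = 1ℙ

  Adj-side : ∀ {u w} → Adj F u w → side w ≡ side u ⁻¹
  Adj-side (ab _) = refl
  Adj-side (ba _) = refl

  Dist-side : ∀ {k u} → Dist k u → side u ≡ parity k ⊕ side s
  Dist-side {zero}  refl = refl
  Dist-side {suc k} {u} du with Dist-parent du
  ... | w , w~u , dw = begin
    side u                  ≡⟨ Adj-side w~u ⟩
    side w ⁻¹               ≡⟨ cong _⁻¹ (Dist-side dw) ⟩
    (parity k ⊕ side s) ⁻¹  ≡⟨ parity-suc-⊕ k (side s) ⟩
    parity (suc k) ⊕ side s ∎
    where open ≡-Reasoning

  Adj⇒Dist-≢ : ∀ {k l u w} → Adj F u w → Dist k u → Dist l w → k ≢ l
  Adj⇒Dist-≢ {u = u} u~w du dw refl =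
    p≢p⁻¹ (side u) (trans (trans (Dist-side du) (sym (Dist-side dw))) (Adj-side u~w))

-- Cycles from bypassed edges

Injective-∷ : ∀ {A : Set} {n} {x : A} {f : Fin n → A} →
              Injective _≡_ _≡_ f → (∀ k → x ≢ f k) → Injective _≡_ _≡_ (x ∷ f)
Injective-∷ f-inj fresh {zero}  {zero}  _ = refl
Injective-∷ f-inj fresh {zero}  {suc j} e = contradiction e (fresh j)
Injective-∷ f-inj fresh {suc i} {zero}  e = contradiction (sym e) (fresh i)
Injective-∷ f-inj fresh {suc i} {suc j} e = cong suc (f-inj e)

module Geodesics (F : BipGraph a b) (y : Fin b) where
  open Layers F (inj₂ y)

  -- Descending from x in layer L + 1 to the source y alternates between the two sides:
  -- x = α 0, β 0, α 1, …, β m = y. Every later vertex lies in a strictly lower layer than the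
  -- one it is prepended to, which is what makes α and β injective.
  record Geodesic (m L : ℕ) (x : Fin a) : Set where
    field
      α           : Fin (suc m) → Fin a
      β           : Fin (suc m) → Fin b
      α-head      : α zero ≡ x
      β-last      : β (fromℕ m) ≡ y
      α-within    : ∀ k → Within (suc L) (inj₁ (α k))
      β-within    : ∀ k → Within L (inj₂ (β k))
      α-injective : Injective _≡_ _≡_ α
      β-injective : Injective _≡_ _≡_ β
      edge₁       : ∀ k → F (α k) (β k) ≡ true
      edge₂       : ∀ (k : Fin m) → F (α (suc k)) (β (inject₁ k)) ≡ true

  private
    start : ∀ {x} → F x y ≡ true → Dist 1 (inj₁ x) → Geodesic 0 0 x
    start {x} e dx = record
      { α = λ _ → x ; β = λ _ → y ; α-head = refl ; β-last = refl
      ; α-within = λ _ → proj₁ dx ; β-within = λ _ → refl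
      ; α-injective = λ { {zero} {zero} _ → refl } ; β-injective = λ { {zero} {zero} _ → refl }
      ; edge₁ = λ _ → e ; edge₂ = λ () }

    extend : ∀ {m L x j x′} → F x j ≡ true → F x′ j ≡ true →
             Dist (suc (suc (suc L))) (inj₁ x) → Dist (suc (suc L)) (inj₂ j) →
             Geodesic m L x′ → Geodesic (suc m) (suc (suc L)) x
    extend {L = L} {x} {j} e e′ dx dj g = record
      { α = x ∷ α ; β = j ∷ β ; α-head = refl ; β-last = β-last
      ; α-within = λ { zero → proj₁ dx ; (suc k) → inj₁ (inj₁ (α-within k)) }
      ; β-within = λ { zero → proj₁ dj ; (suc k) → inj₁ (inj₁ (β-within k)) }
      ; α-injective = Injective-∷ α-injective λ k x≡αk →
          proj₂ dx (subst (Within (suc (suc L)) ∘ inj₁) (sym x≡αk) (inj₁ (α-within k)))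
      ; β-injective = Injective-∷ β-injective λ k j≡βk →
          proj₂ dj (subst (Within (suc L) ∘ inj₂) (sym j≡βk) (inj₁ (β-within k)))
      ; edge₁ = λ { zero → e ; (suc k) → edge₁ k }
      ; edge₂ = λ { zero → subst (λ i → F i j ≡ true) (sym α-head) e′ ; (suc k) → edge₂ k } }
      where open Geodesic g

  geodesic : ∀ L {x} → Dist (suc L) (inj₁ x) → Geodesic ⌊ L /2⌋ L x
  geodesic L dx with Dist-parent dx
  geodesic zero          dx | inj₂ j , ba e , refl = start e dx
  geodesic (suc zero)    dx | inj₂ j , ba e , dj with Dist-parent dj
  ... | inj₁ x′ , ab e′ , ()
  geodesic (suc (suc L)) dx | inj₂ j , ba e , dj with Dist-parent dj
  ... | inj₁ x′ , ab e′ , dx′ = extend e e′ dx dj (geodesic L dx′)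

module _ {E : BipGraph a b} {x : Fin a} {y : Fin b} (exy : E x y ≡ true) where
  open RemoveEdge E x y
  open Layers E′ (inj₂ y)
  open Geodesics E′ y

  Geodesic⇒Cycle : ∀ {m L} → Geodesic m L x → Cycle E
  Geodesic⇒Cycle {zero} g = contradiction
    (trans (sym (subst₂ (λ i j → E′ i j ≡ true) α-head β-last (edge₁ zero))) removeEdge-removes) λ ()
    where open Geodesic g
  Geodesic⇒Cycle {suc m} g = record
    { m = suc m ; m≥1 = s≤s z≤n ; α = α ; β = β
    ; α-inj = α-injective ; β-inj = β-injective
    ; edge₁ = removeEdge-⊆ ∘ edge₁ ; edge₂ = removeEdge-⊆ ∘ edge₂
    ; close = subst₂ (λ i j → E i j ≡ true) (sym α-head) (sym β-last) exy }
    where open Geodesic g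

  closingWalk⇒Cycle : Star (Adj E′) (inj₂ y) (inj₁ x) → Cycle E
  closingWalk⇒Cycle y⇝x with Within⇒Dist (proj₂ (reachable⇒Within y⇝x))
  ... | suc L , dx = Geodesic⇒Cycle (geodesic L dx)

zigzag : (F : BipGraph a b) (n : ℕ) (α : Fin (suc n) → Fin a) (β : Fin (suc n) → Fin b) →
         (∀ k → F (α k) (β k) ≡ true) → (∀ (k : Fin n) → F (α (suc k)) (β (inject₁ k)) ≡ true) →
         Star (Adj F) (inj₂ (β (fromℕ n))) (inj₁ (α zero))
zigzag F zero    α β e₁ e₂ = ba (e₁ zero) ◅ ε
zigzag F (suc n) α β e₁ e₂ = ba (e₁ (fromℕ (suc n))) ◅ ab (e₂ (fromℕ n)) ◅
  zigzag F n (α ∘ inject₁) (β ∘ inject₁) (e₁ ∘ inject₁) (e₂ ∘ inject₁)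

module _ {E : BipGraph a b} (c : Cycle E) where
  open Cycle c

  Cycle-closingWalk : Star (Adj (removeEdge (α zero) (β (fromℕ m)) E)) (inj₂ (β (fromℕ m))) (inj₁ (α zero))
  Cycle-closingWalk = zigzag _ m α β
    (λ k → removeEdge-keeps (edge₁ k) (other k))
    (λ k → removeEdge-keeps (edge₂ k) (inj₁ λ αk≡α0 → contradiction (α-inj αk≡α0) λ ()))
    where
    open RemoveEdge E (α zero) (β (fromℕ m))
    fromℕ≢zero : ∀ {n} → 1 ≤ n → fromℕ n ≢ zero
    fromℕ≢zero (s≤s z≤n) ()

    other : ∀ k → α k ≢ α zero ⊎ β k ≢ β (fromℕ m)
    other zero    = inj₂ λ β0≡βm → fromℕ≢zero m≥1 (sym (β-inj β0≡βm))
    other (suc k) = inj₁ λ αk≡α0 → contradiction (α-inj αk≡α0) λ ()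

-- Vertices against edges in connected graphs

∑ᵥ : (Fin a ⊎ Fin b → ℕ) → ℕ
∑ᵥ {a} {b} f = ∑[ i < a ] f (inj₁ i) + ∑[ j < b ] f (inj₂ j)

∑ᵥ-mono-≤ : {f g : Fin a ⊎ Fin b → ℕ} → (∀ u → f u ≤ g u) → ∑ᵥ f ≤ ∑ᵥ g
∑ᵥ-mono-≤ f≤g = +-mono-≤ (∑-mono-≤ (f≤g ∘ inj₁)) (∑-mono-≤ (f≤g ∘ inj₂))

∑ᵥ-distrib-+ : (f g : Fin a ⊎ Fin b → ℕ) → ∑ᵥ (λ u → f u + g u) ≡ ∑ᵥ f + ∑ᵥ g
∑ᵥ-distrib-+ f g = trans (cong₂ _+_ (∑-distrib-+ (f ∘ inj₁) (g ∘ inj₁)) (∑-distrib-+ (f ∘ inj₂) (g ∘ inj₂)))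
                         (interchange (∑[ i < _ ] f (inj₁ i)) (∑[ i < _ ] g (inj₁ i))
                                      (∑[ j < _ ] f (inj₂ j)) (∑[ j < _ ] g (inj₂ j)))

∑ᵥ-one : ∑ᵥ {a} {b} (λ _ → 1) ≡ a + b
∑ᵥ-one {a} {b} = cong₂ _+_ (trans (∑-const a 1) (*-identityʳ a)) (trans (∑-const b 1) (*-identityʳ b))

∑ᵥ-isVertex : ∀ {a b} (s : Fin a ⊎ Fin b) → ∑ᵥ (λ u → indicator (does (u ≟ᵥ s))) ≡ 1
∑ᵥ-isVertex s@(inj₁ i) = cong₂ _+_
  (count-unique (λ k → inj₁ k ≟ᵥ s) (λ p q → inj₁-injective (trans p (sym q))) {i} refl)
  (count-zero (λ k → inj₂ k ≟ᵥ s) λ _ ())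
∑ᵥ-isVertex s@(inj₂ j) = cong₂ _+_
  (count-zero (λ k → inj₁ k ≟ᵥ s) λ _ ())
  (count-unique (λ k → inj₂ k ≟ᵥ s) (λ p q → inj₂-injective (trans p (sym q))) {j} refl)

module SpanningCount (E : BipGraph a b) (s : Vertex E) (conn : Connected E) where
  open Layers E s

  dist : ∀ u → ∃[ k ] Dist k u
  dist u = Within⇒Dist (proj₂ (reachable⇒Within (conn s u)))

  d : Vertex E → ℕ
  d = proj₁ ∘ dist

  Dist⇒d : ∀ {k u} → Dist k u → d u ≡ k
  Dist⇒d {u = u} du = Dist-unique (proj₂ (dist u)) du

  LowerA : Fin a → Pred (Fin b) 0ℓ
  LowerA i j = T (E i j) × d (inj₂ j) < d (inj₁ i)

  LowerB : Fin b → Pred (Fin a) 0ℓ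
  LowerB j i = T (E i j) × d (inj₁ i) < d (inj₂ j)

  lowerA? : ∀ i → Decidable (LowerA i)
  lowerA? i j = T? (E i j) ×-dec (d (inj₂ j) <? d (inj₁ i))

  lowerB? : ∀ j → Decidable (LowerB j)
  lowerB? j i = T? (E i j) ×-dec (d (inj₁ i) <? d (inj₂ j))

  lowerDegree : Vertex E → ℕ
  lowerDegree (inj₁ i) = count (lowerA? i)
  lowerDegree (inj₂ j) = count (lowerB? j)

  isRoot : Vertex E → ℕ
  isRoot u = indicator (does (u ≟ᵥ s))

  edge-orientation : ∀ i j → indicator (E i j) ≡ indicator (does (lowerA? i j)) + indicator (does (lowerB? j i))
  edge-orientation i j with E i j in e
  ... | false = refl
  ... | true  = sym (indicator-<?-flip λ dj≡di →
    Adj⇒Dist-≢ (ab e) (proj₂ (dist (inj₁ i))) (proj₂ (dist (inj₂ j))) (sym dj≡di))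

  ∑ᵥ-lowerDegree : ∑ᵥ lowerDegree ≡ edgeCount E
  ∑ᵥ-lowerDegree = begin
    ∑ᵥ lowerDegree
      ≡⟨ cong (∑[ i < a ] count (lowerA? i) +_) (∑-comm [B]) ⟩
    ∑[ i < a ] ∑[ j < b ] [A] i j + ∑[ i < a ] ∑[ j < b ] [B] j i
      ≡⟨ ∑-distrib-+ (λ i → ∑[ j < b ] [A] i j) (λ i → ∑[ j < b ] [B] j i) ⟨
    ∑[ i < a ] (∑[ j < b ] [A] i j + ∑[ j < b ] [B] j i)
      ≡⟨ sum-cong-≗ (λ i → ∑-distrib-+ ([A] i) (λ j → [B] j i)) ⟨
    ∑[ i < a ] ∑[ j < b ] ([A] i j + [B] j i)
      ≡⟨ sum-cong-≗ (λ i → sum-cong-≗ (edge-orientation i)) ⟨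
    edgeCount E ∎
    where
    open ≡-Reasoning
    [A] : Fin a → Fin b → ℕ
    [A] i j = indicator (does (lowerA? i j))
    [B] : Fin b → Fin a → ℕ
    [B] j i = indicator (does (lowerB? j i))

  lowerNeighbour : ∀ {u} → u ≢ s → ∃[ w ] (Adj E w u × d w < d u)
  lowerNeighbour {u} u≢s = parentOf (proj₂ (dist u))
    where
    parentOf : ∀ {k} → Dist k u → ∃[ w ] (Adj E w u × d w < d u)
    parentOf {zero}  u≡s = contradiction u≡s u≢s
    parentOf {suc k} du with Dist-parent du
    ... | w , w~u , dw = w , w~u , subst₂ _<_ (sym (Dist⇒d dw)) (sym (Dist⇒d du)) (n<1+n k)

  lowerDegree-pos : ∀ {u} → u ≢ s → 1 ≤ lowerDegree u
  lowerDegree-pos {inj₁ i} u≢s with lowerNeighbour u≢s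
  ... | inj₂ j , ba e , lt = count-pos (lowerA? i) {j} (Equivalence.from Bool.T-≡ e , lt)
  lowerDegree-pos {inj₂ j} u≢s with lowerNeighbour u≢s
  ... | inj₁ i , ab e , lt = count-pos (lowerB? j) {i} (Equivalence.from Bool.T-≡ e , lt)

  lowerDegree-zero : ∀ {u} → d u ≡ 0 → lowerDegree u ≡ 0
  lowerDegree-zero {inj₁ i} du≡0 = count-zero (lowerA? i) λ _ (_ , lt) → n≮0 (subst (_ <_) du≡0 lt)
  lowerDegree-zero {inj₂ j} du≡0 = count-zero (lowerB? j) λ _ (_ , lt) → n≮0 (subst (_ <_) du≡0 lt)

  lowerDegree+isRoot-≥1 : ∀ u → 1 ≤ lowerDegree u + isRoot u
  lowerDegree+isRoot-≥1 u with u ≟ᵥ s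
  ... | yes _   = m≤n+m 1 _
  ... | no  u≢s = ≤-trans (lowerDegree-pos u≢s) (m≤m+n _ _)

  ∑ᵥ-lowerDegree+isRoot : ∑ᵥ (λ u → lowerDegree u + isRoot u) ≡ suc (edgeCount E)
  ∑ᵥ-lowerDegree+isRoot = trans (∑ᵥ-distrib-+ lowerDegree isRoot)
    (trans (cong₂ _+_ ∑ᵥ-lowerDegree (∑ᵥ-isVertex s)) (+-comm _ 1))

  vertices≤edges+1 : a + b ≤ suc (edgeCount E)
  vertices≤edges+1 = subst₂ _≤_ (∑ᵥ-one {a} {b}) ∑ᵥ-lowerDegree+isRoot (∑ᵥ-mono-≤ lowerDegree+isRoot-≥1)

  descend : ∀ {x y k u} → Dist k u → k < d (inj₁ x) ⊎ k < d (inj₂ y) →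
            Star (Adj (removeEdge x y E)) u s
  descend {k = zero}  refl _ = ε
  descend {x} {y} {suc k} {u} du high with Dist-parent du
  ... | w , w~u , dw = RemoveEdge.Adj-removeEdge E x y (Adj-sym w~u) (Sum.map avoid avoid high) ◅
                       descend dw (Sum.map (<-trans (n<1+n k)) (<-trans (n<1+n k)) high)
    where
    avoid : ∀ {v} → suc k < d v → u ≢ v × w ≢ v
    avoid lt = (λ { refl → <⇒≢ lt (sym (Dist⇒d du)) })
             , (λ { refl → <⇒≢ (<-trans (n<1+n k) lt) (sym (Dist⇒d dw)) })

  module _ (acyclic : Acyclic E) where

    lowerA-unique : ∀ i {j₁ j₂} → LowerA i j₁ → LowerA i j₂ → j₁ ≡ j₂
    lowerA-unique i {j₁} {j₂} (t₁ , lt₁) (t₂ , lt₂) with j₁ Fin.≟ j₂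
    ... | yes j₁≡j₂ = j₁≡j₂
    ... | no  j₁≢j₂ = contradiction (closingWalk⇒Cycle (Equivalence.to Bool.T-≡ t₂) walk) acyclic
      where
      walk : Star (Adj (removeEdge i j₂ E)) (inj₂ j₂) (inj₁ i)
      walk = descend (proj₂ (dist (inj₂ j₂))) (inj₁ lt₂)
         ◅◅ reverse Adj-sym (descend (proj₂ (dist (inj₂ j₁))) (inj₁ lt₁))
         ◅◅ return (ba (RemoveEdge.removeEdge-keeps E i j₂ (Equivalence.to Bool.T-≡ t₁) (inj₂ j₁≢j₂)))

    lowerB-unique : ∀ j {i₁ i₂} → LowerB j i₁ → LowerB j i₂ → i₁ ≡ i₂
    lowerB-unique j {i₁} {i₂} (t₁ , lt₁) (t₂ , lt₂) with i₁ Fin.≟ i₂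
    ... | yes i₁≡i₂ = i₁≡i₂
    ... | no  i₁≢i₂ = contradiction (closingWalk⇒Cycle (Equivalence.to Bool.T-≡ t₂) walk) acyclic
      where
      walk : Star (Adj (removeEdge i₂ j E)) (inj₂ j) (inj₁ i₂)
      walk = ba (RemoveEdge.removeEdge-keeps E i₂ j (Equivalence.to Bool.T-≡ t₁) (inj₁ i₁≢i₂))
           ◅ descend (proj₂ (dist (inj₁ i₁))) (inj₂ lt₁)
          ◅◅ reverse Adj-sym (descend (proj₂ (dist (inj₁ i₂))) (inj₂ lt₂))

    lowerDegree+isRoot-≤1 : ∀ u → lowerDegree u + isRoot u ≤ 1
    lowerDegree+isRoot-≤1 u with u ≟ᵥ s
    ... | yes refl = ≤-reflexive (cong (_+ 1) (lowerDegree-zero (Dist⇒d {0} refl)))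
    ... | no  _    = subst (_≤ 1) (sym (+-identityʳ _)) (lowerDegree-≤1 u)
      where
      lowerDegree-≤1 : ∀ v → lowerDegree v ≤ 1
      lowerDegree-≤1 (inj₁ i) = count-≤1 (lowerA? i) (lowerA-unique i)
      lowerDegree-≤1 (inj₂ j) = count-≤1 (lowerB? j) (lowerB-unique j)

    edges+1≤vertices : suc (edgeCount E) ≤ a + b
    edges+1≤vertices = subst₂ _≤_ ∑ᵥ-lowerDegree+isRoot (∑ᵥ-one {a} {b}) (∑ᵥ-mono-≤ lowerDegree+isRoot-≤1)

someVertex : 0 < a + b → Fin a ⊎ Fin b
someVertex {suc a}         _ = inj₁ zero
someVertex {zero} {suc b}  _ = inj₂ zero

module _ {E : BipGraph a b} (nonempty : 0 < a + b) (conn : Connected E) where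

  connected⇒vertices≤edges+1 : a + b ≤ suc (edgeCount E)
  connected⇒vertices≤edges+1 = SpanningCount.vertices≤edges+1 E (someVertex nonempty) conn

  connected⇒[vertices≡edges+1⇔acyclic] : a + b ≡ suc (edgeCount E) ⇔ Acyclic E
  connected⇒[vertices≡edges+1⇔acyclic] = mk⇔ tight⇒acyclic λ acyclic →
    ≤-antisym connected⇒vertices≤edges+1
              (SpanningCount.edges+1≤vertices E (someVertex nonempty) conn acyclic)
    where
    tight⇒acyclic : a + b ≡ suc (edgeCount E) → Acyclic E
    tight⇒acyclic tight c = <-irrefl tight (begin-strict
      a + b                 ≤⟨ SpanningCount.vertices≤edges+1 E′ (someVertex nonempty) conn′ ⟩
      suc (edgeCount E′)    ≤⟨ removeEdge-< close ⟩
      edgeCount E           <⟨ n<1+n _ ⟩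
      suc (edgeCount E)     ∎)
      where
      open Cycle c
      open RemoveEdge E (α zero) (β (fromℕ m))
      open ≤-Reasoning
      conn′ : Connected E′
      conn′ = removeEdge-connected (Cycle-closingWalk c) conn

-- Valency sums

leafWeight : ℕ → ℕ
leafWeight n = n + 2 * indicator (does (n ≟ 1))

leafWeight-≤3 : ∀ {n} → n ≤ 3 → leafWeight n ≤ 3
leafWeight-≤3 {0} _ = z≤n
leafWeight-≤3 {1} _ = ≤-refl
leafWeight-≤3 {2} _ = s≤s (s≤s z≤n)
leafWeight-≤3 {3} _ = ≤-refl
leafWeight-≤3 {suc (suc (suc (suc _)))} (s≤s (s≤s (s≤s ())))

leafWeight≡3⇔ : ∀ n → leafWeight n ≡ 3 ⇔ (n ≡ 3 ⊎ n ≡ 1)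
leafWeight≡3⇔ n = mk⇔ (to n) λ { (inj₁ refl) → refl ; (inj₂ refl) → refl }
  where
  to : ∀ n → leafWeight n ≡ 3 → n ≡ 3 ⊎ n ≡ 1
  to 1 _ = inj₂ refl
  to 3 _ = inj₁ refl

module _ {a b : ℕ} (E : BipGraph a b) where

  degA≡∑ : ∀ i → degA E i ≡ ∑[ j < b ] indicator (E i j)
  degA≡∑ i = listSum-map-tabulate (λ j → indicator (E i j)) id

  degB≡∑ : ∀ j → degB E j ≡ ∑[ i < a ] indicator (E i j)
  degB≡∑ j = listSum-map-tabulate (λ i → indicator (E i j)) id

  numLeavesB≡count : numLeavesB E ≡ count (λ j → degB E j ≟ 1)
  numLeavesB≡count = length-filter-tabulate (λ j → degB E j ≟ 1) id

  edgeCount≡∑degA : edgeCount E ≡ ∑[ i < a ] degA E i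
  edgeCount≡∑degA = sum-cong-≗ (sym ∘ degA≡∑)

  edgeCount≡∑degB : edgeCount E ≡ ∑[ j < b ] degB E j
  edgeCount≡∑degB = trans (∑-comm (λ i j → indicator (E i j))) (sum-cong-≗ (sym ∘ degB≡∑))

  ∑leafWeight : ∑[ j < b ] leafWeight (degB E j) ≡ edgeCount E + 2 * numLeavesB E
  ∑leafWeight = trans (∑-distrib-+ (degB E) (λ j → 2 * indicator (does (degB E j ≟ 1))))
    (cong₂ _+_ (sym edgeCount≡∑degB)
               (trans (sym (*-distribˡ-sum 2 (λ j → indicator (does (degB E j ≟ 1)))))
                      (cong (2 *_) (sym numLeavesB≡count))))

  edgeCount≤a*3 : (∀ i → degA E i ≤ 3) →
                edgeCount E ≤ a * 3 × (edgeCount E ≡ a * 3 ⇔ (∀ i → degA E i ≡ 3))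
  edgeCount≤a*3 degA≤3 rewrite edgeCount≡∑degA = ∑≤n*c degA≤3

  edgeCount+2*leaves≤b*3 : (∀ j → degB E j ≤ 3) →
                       edgeCount E + 2 * numLeavesB E ≤ b * 3
                       × (edgeCount E + 2 * numLeavesB E ≡ b * 3 ⇔ (∀ j → degB E j ≡ 3 ⊎ degB E j ≡ 1))
  edgeCount+2*leaves≤b*3 degB≤3 rewrite sym ∑leafWeight with ∑≤n*c (leafWeight-≤3 ∘ degB≤3)
  ... | bound , tight = bound , ⇔.trans tight (mk⇔ (λ w j → Equivalence.to (leafWeight≡3⇔ _) (w j))
                                                   (λ d j → Equivalence.from (leafWeight≡3⇔ _) (d j)))

proposition5p2 : (a b : ℕ) (E : BipGraph a b) → 0 < a + b → Connected E → MaxValency≤3 E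
  → (4 * numLeavesB E ≤ 3 * (b + 1))
    × ((4 * numLeavesB E ≡ 3 * (b + 1))
      ⇔ (IsTree E × (∀ i → degA E i ≡ 3) × (∀ j → degB E j ≡ 3 ⊎ degB E j ≡ 1)))
proposition5p2 a b E nonempty conn (degA≤3 , degB≤3) =
  let edges≤ , regularA⇔ = edgeCount≤a*3 E degA≤3
      edges+leaves≤ , leafyB⇔ = edgeCount+2*leaves≤b*3 E degB≤3
      bound , extremal⇔ = leafBound {a} {b} {edgeCount E} {numLeavesB E}
                            (connected⇒vertices≤edges+1 nonempty conn) edges≤ edges+leaves≤
  in bound , ⇔.trans extremal⇔ (tree⇔ ×-⇔ regularA⇔ ×-⇔ leafyB⇔)
  where
  tree⇔ : a + b ≡ suc (edgeCount E) ⇔ IsTree E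
  tree⇔ = ⇔.trans (connected⇒[vertices≡edges+1⇔acyclic] nonempty conn) (mk⇔ (conn ,_) proj₂)
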